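{- Let $r\ge2$ and let $\lambda=(3,2,1,\dots,1)$ with $r$ parts equal to $1$ (so $\lambda$ has $r+2$ parts) and $\mu=(2,1)$; thus the diagram of $\lambda/\mu$ consists of the boxes $(1,3),(2,2)$ and $(i,1)$ for $3\le i\le r+2$, with $r+2\ge4$ boxes. Then $\mathcal{P}_{\lambda/\mu,\mathbf{1}}$ is non-integral, where $\mathbf{1}=(1,\dots,1)$ has $r+2$ parts.
   Context: The diagram of $\lambda/\mu$ is $\{(i,j):\mu_i<j\le\lambda_i\}$ (row $i$, column $j$). For a composition $\mathbf{w}=(w_1,\dots,w_{m-1})$ of positive integers, a Gelfand--Tsetlin pattern is a real array $(x^i_j)_{1\le i\le m,\,1\le j\le n}$ ($n$ at least the length of $\lambda$, partitions padded with zeros) with $x^{i+1}_j\ge x^i_j$ and $x^i_j\ge x^{i+1}_{j+1}$ whenever defined; $\mathcal{P}_{\lambda/\mu,\mathbf{w}}\subset\mathbb{R}^{mn}$ is the polytope of such patterns with $\mathbf{x}^m=\lambda$, $\mathbf{x}^1=\mu$, and $\sum_jx^{i+1}_j-\sum_jx^i_j=w_i$ for all $i$. A polytope is non-integral if some vertex is not a lattice point.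
   Formalization: The polytope $\mathcal{P}_{\lambda/\mu,\mathbf{1}}$ is taken in ℚ^(mn) instead of $\mathbb{R}^{mn}$, so its vertices and the points against which their extremality is tested have rational coordinates. -}

module Defs where

import Data.Nat as ℕ
open import Data.Nat using (ℕ; suc)
import Data.Fin
import Relation.Binary.PropositionalEquality
open import Data.Integer using (ℤ; +_)
open import Data.Fin using (Fin; zero; suc; inject₁)
open import Data.Rational using (ℚ; _+_; _-_; _*_; _≤_; ½; _/_)
open import Data.Vec.Functional using (foldr)
open import Data.Product using (Σ; _×_)
open import Relation.Nullary using (¬_)
open import Relation.Binary.PropositionalEquality using (_≡_)

ℕ→ℚ : ℕ → ℚ
ℕ→ℚ k = (+ k) / 1

rowSum : ∀ {n} → (Fin n → ℚ) → ℚ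
rowSum v = foldr _+_ (ℕ→ℚ 0) v

-- A point of ℚ^{m n} with m = suc M rows; row index i : Fin (suc M)
-- (row 0 is x^1, row M is x^m), column index j : Fin n.
Point : ℕ → ℕ → Set
Point M n = Fin (suc M) → Fin n → ℚ

-- Membership in the Gelfand–Tsetlin polytope P_{λ/μ,w}:
-- λ μ : Fin n → ℕ (partitions padded with zeros), w : Fin M → ℕ (w_1..w_{m-1}).
record InGT {M n : ℕ} (lam mu : Fin n → ℕ) (w : Fin M → ℕ) (x : Point M n) : Set where
  field
    top    : ∀ j → x (Data.Fin.fromℕ M) j ≡ ℕ→ℚ (lam j)
    bottom : ∀ j → x zero j ≡ ℕ→ℚ (mu j)
    colIneq  : ∀ (i : Fin M) (j : Fin n) → x (inject₁ i) j ≤ x (suc i) j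
    diagIneq : ∀ (i : Fin M) (j j' : Fin n) → Data.Fin.toℕ j' ≡ suc (Data.Fin.toℕ j) →
               x (suc i) j' ≤ x (inject₁ i) j
    weight : ∀ (i : Fin M) → rowSum (x (suc i)) - rowSum (x (inject₁ i)) ≡ ℕ→ℚ (w i)

record IsVertex {M n : ℕ} (lam mu : Fin n → ℕ) (w : Fin M → ℕ) (x : Point M n) : Set where
  field
    mem     : InGT lam mu w x
    extreme : ∀ (y z : Point M n) → InGT lam mu w y → InGT lam mu w z →
              (∀ i j → x i j ≡ (y i j + z i j) * ½) → ∀ i j → y i j ≡ z i j

IsIntegerℚ : ℚ → Set
IsIntegerℚ q = Σ ℤ (λ k → q ≡ k / 1)

NonIntegral : {M n : ℕ} (lam mu : Fin n → ℕ) (w : Fin M → ℕ) → Set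
NonIntegral {M} {n} lam mu w =
  Σ (Point M n) (λ x → IsVertex lam mu w x × Σ (Fin (suc M)) (λ i → Σ (Fin n) (λ j → ¬ IsIntegerℚ (x i j))))

lamR : (r : ℕ) → Fin (2 ℕ.+ r) → ℕ
lamR r zero = 3
lamR r (suc zero) = 2
lamR r (suc (suc _)) = 1

muR : (r : ℕ) → Fin (2 ℕ.+ r) → ℕ
muR r zero = 2
muR r (suc zero) = 1
muR r (suc (suc _)) = 0

oneR : (r : ℕ) → Fin (2 ℕ.+ r) → ℕ
oneR r _ = 1

-- A point of the polytope gives every box of λ/μ a monotone path from 0 to 1 along the
-- rows x^1, …, x^m (on top of μ_j): column 1 carries the box (1,3), column 2 the box (2,2) and
-- column 2 + c the box (2 + c, 1). The witness adds, in each of the first four steps, half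
-- of two of the boxes (2,2), (3,1), (4,1), (1,3), and then the boxes (5,1), …, (r+2,1)
-- one per step; so x^2_3 = ½. Every integral entry of x sits at its bound μ_j or λ_j, hence
-- is shared by any two points of the polytope with midpoint x. The inequalities
-- x^2_3 ≤ x^3_3, x^3_4 ≤ x^4_4 and x^3_4 ≤ x^2_3 are tight at x, hence at both points, so
-- four of the six half-integral entries agree; the sum of row 3 forces them to be ½, and
-- the sums of rows 2 and 4 fix the other two.

module Submission where

open import Defs

open import Data.Fin using (Fin; suc; toℕ; inject₁)
open import Data.Fin.Induction using (<-weakInduction; >-weakInduction)
open import Data.Fin.Patterns using (0F; 1F; 2F; 3F)
import Data.Fin.Properties as Fin
import Data.Integer as ℤ
import Data.Integer.Properties as ℤ
open import Data.Integer.GCD using (gcd)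
open import Data.Nat as ℕ using (ℕ; zero; suc; _≤_; _<_; z≤n; s≤s)
import Data.Nat.Properties as ℕ
open import Data.Product using (_,_)
open import Data.Rational as ℚ using (ℚ; _+_; _-_; _*_; ½; 0ℚ; 1ℚ; ↧_)
import Data.Rational.Properties as ℚ
open import Data.Rational.Solver using (module +-*-Solver)
open import Data.Sum using (_⊎_; inj₁; inj₂)
open import Relation.Binary.PropositionalEquality
open import Relation.Nullary using (¬_)

open import Algebra.Definitions.RawMonoid ℚ.+-0-rawMonoid using (_×_)
open import Algebra.Properties.Group ℚ.+-0-group using ()
  renaming (∙-cancelˡ to +-cancelˡ; ∙-cancelʳ to +-cancelʳ)
open import Algebra.Properties.Monoid.Mult ℚ.+-0-monoid using (×-homo-+)
open import Algebra.Properties.Monoid.Sum ℚ.+-0-monoid using (sum-cong-≗; sum-replicate-zero)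

open +-*-Solver

½-nonInteger : ¬ IsIntegerℚ ½
½-nonInteger (m , ½≡m/1) = 2≢1 (ℕ.m*n≡1⇒m≡1 2 ℤ.∣ g ∣ 2∣g∣≡1)
  where
  g : ℤ.ℤ
  g = gcd m (ℤ.+ 1)
  2∣g∣≡1 : 2 ℕ.* ℤ.∣ g ∣ ≡ 1
  2∣g∣≡1 = trans (sym (ℤ.abs-* (ℤ.+ 2) g))
    (cong ℤ.∣_∣ (subst (λ q → ↧ q ℤ.* g ≡ ℤ.+ 1) (sym ½≡m/1) (ℚ.↧-/ m 1)))
  2≢1 : 2 ≢ 1
  2≢1 ()

*½-injective : ∀ {p q} → p * ½ ≡ q * ½ → p ≡ q
*½-injective eq = ℚ.≤-antisym (ℚ.*-cancelʳ-≤-pos ½ (ℚ.≤-reflexive eq))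
                              (ℚ.*-cancelʳ-≤-pos ½ (ℚ.≤-reflexive (sym eq)))

halve-double : ∀ c → c ≡ (c + c) * ½
halve-double = solve 1 (λ c → c := (c :+ c) :* con ½) refl

midpoint-squeeze : ∀ {a b c d} → a ℚ.≤ b → c ℚ.≤ d → (a + c) * ½ ≡ (b + d) * ½ → a ≡ b
midpoint-squeeze a≤b c≤d eq = ℚ.≤-antisym a≤b (ℚ.≮⇒≥ λ a<b →
  ℚ.<-irrefl (*½-injective eq) (ℚ.+-mono-<-≤ a<b c≤d))

step : ℕ → ℕ → ℚ
step t       zero    = 0ℚ
step zero    (suc a) = 1ℚ
step (suc t) (suc a) = step t a

halfStep : ℕ → ℕ → ℕ → ℚ
halfStep s t a = ½ * (step s a + step t a)

step-nonNeg : ∀ t a → 0ℚ ℚ.≤ step t a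
step-nonNeg t       zero    = ℚ.≤-refl
step-nonNeg zero    (suc a) = ℚ.nonNegative⁻¹ 1ℚ
step-nonNeg (suc t) (suc a) = step-nonNeg t a

step-≤1 : ∀ t a → step t a ℚ.≤ 1ℚ
step-≤1 t       zero    = ℚ.nonNegative⁻¹ 1ℚ
step-≤1 zero    (suc a) = ℚ.≤-refl
step-≤1 (suc t) (suc a) = step-≤1 t a

step-mono : ∀ t a → step t a ℚ.≤ step t (suc a)
step-mono t       zero    = step-nonNeg t 1
step-mono zero    (suc a) = ℚ.≤-refl
step-mono (suc t) (suc a) = step-mono t a

step-antitone : ∀ {s t} a → s ≤ t → step t a ℚ.≤ step s a
step-antitone         zero    _         = ℚ.≤-refl
step-antitone {zero}  {t}     (suc a) _ = step-≤1 t (suc a)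
step-antitone {suc s} {suc t} (suc a) (s≤s s≤t) = step-antitone a s≤t

step-≡1 : ∀ {t a} → t < a → step t a ≡ 1ℚ
step-≡1 {zero}  {suc a} _         = refl
step-≡1 {suc t} {suc a} (s≤s t<a) = step-≡1 t<a

step-0∨1 : ∀ t a → step t a ≡ 0ℚ ⊎ step t a ≡ 1ℚ
step-0∨1 t       zero    = inj₁ refl
step-0∨1 zero    (suc a) = inj₂ refl
step-0∨1 (suc t) (suc a) = step-0∨1 t a

rowSum-step : ∀ {m} a → a ≤ m → rowSum (λ (d : Fin m) → step (toℕ d) a) ≡ a × 1ℚ
rowSum-step {m}     zero    _         = sum-replicate-zero m
rowSum-step {suc m} (suc a) (s≤s a≤m) = cong (1ℚ +_) (rowSum-step a a≤m)

halfStep-nonNeg : ∀ s t a → 0ℚ ℚ.≤ halfStep s t a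
halfStep-nonNeg s t a = ℚ.*-monoˡ-≤-nonNeg ½ (ℚ.+-mono-≤ (step-nonNeg s a) (step-nonNeg t a))

halfStep-≤1 : ∀ s t a → halfStep s t a ℚ.≤ 1ℚ
halfStep-≤1 s t a = ℚ.*-monoˡ-≤-nonNeg ½ (ℚ.+-mono-≤ (step-≤1 s a) (step-≤1 t a))

halfStep-mono : ∀ s t a → halfStep s t a ℚ.≤ halfStep s t (suc a)
halfStep-mono s t a = ℚ.*-monoˡ-≤-nonNeg ½ (ℚ.+-mono-≤ (step-mono s a) (step-mono t a))

step≤halfStep : ∀ {s t} a → s ≤ t → step t a ℚ.≤ halfStep s t a
step≤halfStep {s} {t} a s≤t = begin
  step t a                   ≡⟨ solve 1 (λ u → u := con ½ :* (u :+ u)) refl (step t a) ⟩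
  ½ * (step t a + step t a)  ≤⟨ ℚ.*-monoˡ-≤-nonNeg ½ (ℚ.+-monoˡ-≤ (step t a) (step-antitone a s≤t)) ⟩
  halfStep s t a             ∎
  where open ℚ.≤-Reasoning

module _ {M n : ℕ} {lam mu : Fin n → ℕ} {w : Fin M → ℕ} where

  InGT⇒mu≤ : ∀ {u} → InGT lam mu w u → ∀ i j → ℕ→ℚ (mu j) ℚ.≤ u i j
  InGT⇒mu≤ {u} u∈P i j = <-weakInduction (λ i → ℕ→ℚ (mu j) ℚ.≤ u i j)
    (ℚ.≤-reflexive (sym (InGT.bottom u∈P j)))
    (λ i mu≤u → ℚ.≤-trans mu≤u (InGT.colIneq u∈P i j)) i

  InGT⇒≤lam : ∀ {u} → InGT lam mu w u → ∀ i j → u i j ℚ.≤ ℕ→ℚ (lam j)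
  InGT⇒≤lam {u} u∈P i j = >-weakInduction (λ i → u i j ℚ.≤ ℕ→ℚ (lam j))
    (ℚ.≤-reflexive (InGT.top u∈P j))
    (λ i u≤lam → ℚ.≤-trans (InGT.colIneq u∈P i j) u≤lam) i

  rowSum-invariant : ∀ {u v} → InGT lam mu w u → InGT lam mu w v →
                     ∀ i → rowSum (u i) ≡ rowSum (v i)
  rowSum-invariant {u} {v} u∈P v∈P = >-weakInduction (λ i → rowSum (u i) ≡ rowSum (v i))
    (sum-cong-≗ (λ j → trans (InGT.top u∈P j) (sym (InGT.top v∈P j))))
    step-down
    where
    subtrahend : ∀ p q → q ≡ p - (p - q)
    subtrahend = solve 2 (λ p q → q := p :- (p :- q)) refl
    step-down : ∀ i → rowSum (u (suc i)) ≡ rowSum (v (suc i)) →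
                rowSum (u (inject₁ i)) ≡ rowSum (v (inject₁ i))
    step-down i eq = begin
      rowSum (u (inject₁ i))                                     ≡⟨ subtrahend (rowSum (u (suc i))) _ ⟩
      rowSum (u (suc i)) - (rowSum (u (suc i)) - rowSum (u (inject₁ i)))
        ≡⟨ cong₂ _-_ eq (trans (InGT.weight u∈P i) (sym (InGT.weight v∈P i))) ⟩
      rowSum (v (suc i)) - (rowSum (v (suc i)) - rowSum (v (inject₁ i))) ≡⟨ subtrahend (rowSum (v (suc i))) _ ⟨
      rowSum (v (inject₁ i))                                     ∎
      where open ≡-Reasoning

  module Midpoint {x y z : Point M n} (y∈P : InGT lam mu w y) (z∈P : InGT lam mu w z)
                  (mid : ∀ i j → x i j ≡ (y i j + z i j) * ½) where

    tight : ∀ {i j i′ j′} → (∀ {u} → InGT lam mu w u → u i j ℚ.≤ u i′ j′) →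
            x i j ≡ x i′ j′ → y i j ≡ y i′ j′
    tight {i} {j} {i′} {j′} valid eq =
      midpoint-squeeze (valid y∈P) (valid z∈P) (trans (sym (mid i j)) (trans eq (mid i′ j′)))

    at-mu : ∀ i j → x i j ≡ ℕ→ℚ (mu j) → y i j ≡ x i j
    at-mu i j eq = sym (trans eq (midpoint-squeeze (InGT⇒mu≤ y∈P i j) (InGT⇒mu≤ z∈P i j)
      (trans (sym (halve-double _)) (trans (sym eq) (mid i j)))))

    at-lam : ∀ i j → x i j ≡ ℕ→ℚ (lam j) → y i j ≡ x i j
    at-lam i j eq = trans (midpoint-squeeze (InGT⇒≤lam y∈P i j) (InGT⇒≤lam z∈P i j)
      (trans (sym (mid i j)) (trans eq (halve-double _)))) (sym eq)

-- X a c is the entry x^{a+1}_{c+1} of the witness, whatever r is; step t a = [t < a]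
-- adds a box between rows t and t + 1, and halfStep s t adds half a box there and half
-- between rows s and s + 1.
X : ℕ → ℕ → ℚ
X a 0 = ℕ→ℚ 2 + halfStep 2 3 a
X a 1 = ℕ→ℚ 1 + halfStep 0 1 a
X a 2 = halfStep 0 2 a
X a 3 = halfStep 1 3 a
X a (suc (suc (suc (suc d)))) = step (4 ℕ.+ d) a

X-mono : ∀ a c → X a c ℚ.≤ X (suc a) c
X-mono a 0 = ℚ.+-monoʳ-≤ (ℕ→ℚ 2) (halfStep-mono 2 3 a)
X-mono a 1 = ℚ.+-monoʳ-≤ (ℕ→ℚ 1) (halfStep-mono 0 1 a)
X-mono a 2 = halfStep-mono 0 2 a
X-mono a 3 = halfStep-mono 1 3 a
X-mono a (suc (suc (suc (suc d)))) = step-mono (4 ℕ.+ d) a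

halfStep≤1+halfStep : ∀ s t a s′ t′ a′ → halfStep s t a ℚ.≤ ℕ→ℚ 1 + halfStep s′ t′ a′
halfStep≤1+halfStep s t a s′ t′ a′ =
  ℚ.≤-trans (halfStep-≤1 s t a) (ℚ.+-monoʳ-≤ (ℕ→ℚ 1) (halfStep-nonNeg s′ t′ a′))

X-diag : ∀ a c → X (suc a) (suc c) ℚ.≤ X a c
X-diag a 0 = begin
  ℕ→ℚ 1 + halfStep 0 1 (suc a)                ≤⟨ ℚ.+-monoʳ-≤ (ℕ→ℚ 1) (halfStep≤1+halfStep 0 1 (suc a) 2 3 a) ⟩
  ℕ→ℚ 1 + (ℕ→ℚ 1 + halfStep 2 3 a)          ≡⟨ ℚ.+-assoc (ℕ→ℚ 1) (ℕ→ℚ 1) (halfStep 2 3 a) ⟨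
  ℕ→ℚ 2 + halfStep 2 3 a                      ∎
  where open ℚ.≤-Reasoning
X-diag a 1 = halfStep≤1+halfStep 0 2 (suc a) 0 1 a
X-diag a 2 = ℚ.≤-refl
X-diag a 3 = step≤halfStep a (s≤s z≤n)
X-diag a (suc (suc (suc (suc d)))) = ℚ.≤-refl

headSum : ∀ {k} → (Fin (4 ℕ.+ k) → ℚ) → ℚ
headSum f = f 0F + (f 1F + (f 2F + f 3F))

rowSum-split : ∀ {k} (f : Fin (4 ℕ.+ k) → ℚ) →
               rowSum f ≡ headSum f + rowSum (λ d → f (suc (suc (suc (suc d)))))
rowSum-split f = solve 5 (λ a b c d s → a :+ (b :+ (c :+ (d :+ s))) := (a :+ (b :+ (c :+ d))) :+ s)
                   refl (f 0F) (f 1F) (f 2F) (f 3F) _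

rowSum-X : ∀ {k} a → a ≤ 4 ℕ.+ k → rowSum (λ (j : Fin (4 ℕ.+ k)) → X a (toℕ j)) ≡ (3 ℕ.+ a) × 1ℚ
rowSum-X {k} a a≤4+k = trans (rowSum-split {k} (λ j → X a (toℕ j))) (head+staircase a a≤4+k)
  where
  head+staircase : ∀ a → a ≤ 4 ℕ.+ k →
    headSum (λ (j : Fin (4 ℕ.+ k)) → X a (toℕ j)) + rowSum (λ (d : Fin k) → step (4 ℕ.+ toℕ d) a)
      ≡ (3 ℕ.+ a) × 1ℚ
  head+staircase 0 _ = cong (ℕ→ℚ 3 +_) (sum-replicate-zero k)
  head+staircase 1 _ = cong (ℕ→ℚ 4 +_) (sum-replicate-zero k)
  head+staircase 2 _ = cong (ℕ→ℚ 5 +_) (sum-replicate-zero k)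
  head+staircase 3 _ = cong (ℕ→ℚ 6 +_) (sum-replicate-zero k)
  head+staircase (suc (suc (suc (suc e)))) (s≤s (s≤s (s≤s (s≤s e≤k)))) =
    trans (cong (ℕ→ℚ 7 +_) (rowSum-step e e≤k)) (sym (×-homo-+ 1ℚ 7 e))

module Vertex (k : ℕ) where

  x : Point (4 ℕ.+ k) (4 ℕ.+ k)
  x a j = X (toℕ a) (toℕ j)

  P : Point (4 ℕ.+ k) (4 ℕ.+ k) → Set
  P = InGT (lamR (2 ℕ.+ k)) (muR (2 ℕ.+ k)) (oneR (2 ℕ.+ k))

  x∈P : P x
  x∈P = record
    { top      = λ j → trans (cong (λ a → X a (toℕ j)) (Fin.toℕ-fromℕ (4 ℕ.+ k))) (top j)
    ; bottom   = bottom
    ; colIneq  = colIneq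
    ; diagIneq = diagIneq
    ; weight   = weight
    }
    where
    top : ∀ j → X (4 ℕ.+ k) (toℕ j) ≡ ℕ→ℚ (lamR (2 ℕ.+ k) j)
    top 0F = refl
    top 1F = refl
    top 2F = refl
    top 3F = refl
    top (suc (suc (suc (suc d)))) = step-≡1 (Fin.toℕ<n d)

    bottom : ∀ j → X 0 (toℕ j) ≡ ℕ→ℚ (muR (2 ℕ.+ k) j)
    bottom 0F = refl
    bottom 1F = refl
    bottom 2F = refl
    bottom 3F = refl
    bottom (suc (suc (suc (suc d)))) = refl

    colIneq : ∀ i j → x (inject₁ i) j ℚ.≤ x (suc i) j
    colIneq i j rewrite Fin.toℕ-inject₁ i = X-mono (toℕ i) (toℕ j)

    diagIneq : ∀ i j j′ → toℕ j′ ≡ suc (toℕ j) → x (suc i) j′ ℚ.≤ x (inject₁ i) j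
    diagIneq i j j′ j′≡1+j rewrite Fin.toℕ-inject₁ i | j′≡1+j = X-diag (toℕ i) (toℕ j)

    weight : ∀ i → rowSum (x (suc i)) - rowSum (x (inject₁ i)) ≡ ℕ→ℚ 1
    weight i rewrite Fin.toℕ-inject₁ i = begin
      rowSum (x (suc i)) - rowSum (λ (j : Fin (4 ℕ.+ k)) → X (toℕ i) (toℕ j))
        ≡⟨ cong₂ _-_ (rowSum-X (suc (toℕ i)) (Fin.toℕ<n i)) (rowSum-X {k} (toℕ i) (ℕ.<⇒≤ (Fin.toℕ<n i))) ⟩
      (4 ℕ.+ toℕ i) × 1ℚ - (3 ℕ.+ toℕ i) × 1ℚ
        ≡⟨ solve 1 (λ v → (con 1ℚ :+ v) :- v := con 1ℚ) refl ((3 ℕ.+ toℕ i) × 1ℚ) ⟩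
      1ℚ ∎
      where open ≡-Reasoning

  module Extreme {y z : Point (4 ℕ.+ k) (4 ℕ.+ k)} (y∈P : P y) (z∈P : P z)
                 (mid : ∀ i j → x i j ≡ (y i j + z i j) * ½) where

    open Midpoint y∈P z∈P mid

    y≡x-staircase : ∀ a d → y a (suc (suc (suc (suc d)))) ≡ x a (suc (suc (suc (suc d))))
    y≡x-staircase a d with step-0∨1 (4 ℕ.+ toℕ d) (toℕ a)
    ... | inj₁ x≡0 = at-mu a _ x≡0
    ... | inj₂ x≡1 = at-lam a _ x≡1

    head-balance : ∀ a → headSum (y a) ≡ headSum (x a)
    head-balance a = +-cancelʳ (rowSum (λ d → x a (suc (suc (suc (suc d)))))) _ _ (begin
      headSum (y a) + rowSum (λ d → x a (suc (suc (suc (suc d))))) ≡⟨ cong (headSum (y a) +_) (sum-cong-≗ (y≡x-staircase a)) ⟨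
      headSum (y a) + rowSum (λ d → y a (suc (suc (suc (suc d))))) ≡⟨ rowSum-split (y a) ⟨
      rowSum (y a)                                                 ≡⟨ rowSum-invariant y∈P x∈P a ⟩
      rowSum (x a)                                                 ≡⟨ rowSum-split (x a) ⟩
      headSum (x a) + rowSum (λ d → x a (suc (suc (suc (suc d))))) ∎)
      where open ≡-Reasoning

    y₁₂≡y₂₂ : y 1F 2F ≡ y 2F 2F
    y₁₂≡y₂₂ = tight (λ u∈P → InGT.colIneq u∈P 1F 2F) refl

    y₂₃≡y₃₃ : y 2F 3F ≡ y 3F 3F
    y₂₃≡y₃₃ = tight (λ u∈P → InGT.colIneq u∈P 2F 3F) refl

    y₂₃≡y₁₂ : y 2F 3F ≡ y 1F 2F
    y₂₃≡y₁₂ = tight (λ u∈P → InGT.diagIneq u∈P 1F 2F 3F refl) refl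

    y₁₂≡½ : y 1F 2F ≡ ½
    y₁₂≡½ = begin
      y 1F 2F                    ≡⟨ halve-double (y 1F 2F) ⟩
      (y 1F 2F + y 1F 2F) * ½    ≡⟨ cong (_* ½) (cancel-head (y 1F 2F + y 1F 2F) row₂) ⟩
      (x 2F 2F + x 2F 3F) * ½    ≡⟨⟩
      ½                          ∎
      where
      open ≡-Reasoning
      cancel-head : ∀ u → x 2F 0F + (x 2F 1F + u) ≡ headSum (x 2F) → u ≡ x 2F 2F + x 2F 3F
      cancel-head u eq = +-cancelˡ (x 2F 1F) u (x 2F 2F + x 2F 3F)
        (+-cancelˡ (x 2F 0F) (x 2F 1F + u) (x 2F 1F + (x 2F 2F + x 2F 3F)) eq)
      row₂ : x 2F 0F + (x 2F 1F + (y 1F 2F + y 1F 2F)) ≡ headSum (x 2F)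
      row₂ = begin
        x 2F 0F + (x 2F 1F + (y 1F 2F + y 1F 2F))
          ≡⟨ cong₂ _+_ (at-mu 2F 0F refl) (cong₂ _+_ (at-lam 2F 1F refl) (cong₂ _+_ (sym y₁₂≡y₂₂) y₂₃≡y₁₂)) ⟨
        headSum (y 2F) ≡⟨ head-balance 2F ⟩
        headSum (x 2F) ∎

    y₁₁ : y 1F 1F ≡ x 1F 1F
    y₁₁ = +-cancelʳ (x 1F 2F + x 1F 3F) (y 1F 1F) (x 1F 1F)
            (+-cancelˡ (x 1F 0F) (y 1F 1F + (x 1F 2F + x 1F 3F)) (x 1F 1F + (x 1F 2F + x 1F 3F)) row₁)
      where
      open ≡-Reasoning
      y₁₂ : y 1F 2F ≡ x 1F 2F
      y₁₂ = y₁₂≡½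
      row₁ : x 1F 0F + (y 1F 1F + (x 1F 2F + x 1F 3F)) ≡ headSum (x 1F)
      row₁ = begin
        x 1F 0F + (y 1F 1F + (x 1F 2F + x 1F 3F))
          ≡⟨ cong₂ _+_ (at-mu 1F 0F refl) (cong (y 1F 1F +_) (cong₂ _+_ y₁₂ (at-mu 1F 3F refl))) ⟨
        headSum (y 1F) ≡⟨ head-balance 1F ⟩
        headSum (x 1F) ∎

    y₃₃ : y 3F 3F ≡ x 3F 3F
    y₃₃ = trans (sym y₂₃≡y₃₃) (trans y₂₃≡y₁₂ y₁₂≡½)

    y₃₀ : y 3F 0F ≡ x 3F 0F
    y₃₀ = +-cancelʳ (x 3F 1F + (x 3F 2F + x 3F 3F)) (y 3F 0F) (x 3F 0F) row₃
      where
      open ≡-Reasoning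
      row₃ : y 3F 0F + (x 3F 1F + (x 3F 2F + x 3F 3F)) ≡ headSum (x 3F)
      row₃ = begin
        y 3F 0F + (x 3F 1F + (x 3F 2F + x 3F 3F))
          ≡⟨ cong (y 3F 0F +_) (cong₂ _+_ (at-lam 3F 1F refl) (cong₂ _+_ (at-lam 3F 2F refl) y₃₃)) ⟨
        headSum (y 3F) ≡⟨ head-balance 3F ⟩
        headSum (x 3F) ∎

    y≡x : ∀ a j → y a j ≡ x a j
    y≡x a (suc (suc (suc (suc d)))) = y≡x-staircase a d
    y≡x 0F j  = trans (InGT.bottom y∈P j) (sym (InGT.bottom x∈P j))
    y≡x 1F 0F = at-mu 1F 0F refl
    y≡x 1F 1F = y₁₁
    y≡x 1F 2F = y₁₂≡½
    y≡x 1F 3F = at-mu 1F 3F refl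
    y≡x 2F 0F = at-mu 2F 0F refl
    y≡x 2F 1F = at-lam 2F 1F refl
    y≡x 2F 2F = trans (sym y₁₂≡y₂₂) y₁₂≡½
    y≡x 2F 3F = trans y₂₃≡y₁₂ y₁₂≡½
    y≡x 3F 0F = y₃₀
    y≡x 3F 1F = at-lam 3F 1F refl
    y≡x 3F 2F = at-lam 3F 2F refl
    y≡x 3F 3F = y₃₃
    y≡x a@(suc (suc (suc (suc _)))) 0F = at-lam a 0F refl
    y≡x a@(suc (suc (suc (suc _)))) 1F = at-lam a 1F refl
    y≡x a@(suc (suc (suc (suc _)))) 2F = at-lam a 2F refl
    y≡x a@(suc (suc (suc (suc _)))) 3F = at-lam a 3F refl

  x-isVertex : IsVertex (lamR (2 ℕ.+ k)) (muR (2 ℕ.+ k)) (oneR (2 ℕ.+ k)) x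
  x-isVertex = record { mem = x∈P ; extreme = extreme }
    where
    extreme : ∀ y z → P y → P z → (∀ i j → x i j ≡ (y i j + z i j) * ½) → ∀ i j → y i j ≡ z i j
    extreme y z y∈P z∈P mid i j = trans (Extreme.y≡x y∈P z∈P mid i j) (sym (Extreme.y≡x z∈P y∈P mid′ i j))
      where
      mid′ : ∀ i j → x i j ≡ (z i j + y i j) * ½
      mid′ i j = trans (mid i j) (cong (_* ½) (ℚ.+-comm (y i j) (z i j)))

mainTheorem15 : (r : ℕ) → 2 ≤ r → NonIntegral (lamR r) (muR r) (oneR r)
mainTheorem15 (suc (suc k)) (s≤s (s≤s z≤n)) = x , x-isVertex , 1F , 2F , ½-nonInteger
  where open Vertex k
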